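{- Let $G$ be a graph on $n$ vertices and let $\omega_u$ be the uniform weight function on $G$, i.e. $\omega_u(v)=1/n$ for every $v\in V(G)$. If the weighted graph $(G,\omega_u)$ has a sparse half, then $G$ contains a set of $\lfloor n/2\rfloor$ vertices spanning at most $n^2/50$ edges.
   Context: A weight function on a graph $G$ is a map $\omega:V(G)\to(0,1)$ with $\sum_{v\in V(G)}\omega(v)=1$; the pair $(G,\omega)$ is a weighted graph. A half of $(G,\omega)$ is a function $s:V(G)\to\mathbb{R}_{\ge 0}$ with $s(v)\le\omega(v)$ for all $v$ and $\sum_{v\in V(G)}s(v)=1/2$. For an edge $e=uv$ put $s(e)=s(u)s(v)$ and $s(E(G))=\sum_{e\in E(G)}s(e)$. A half $s$ is a sparse half if $s(E(G))\le 1/50$.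
   Formalization: The sparse half of $(G,\omega_u)$ in the hypothesis takes only rational values, instead of values in $\mathbb{R}_{\ge 0}$. -}

module Defs where

open import Data.Nat using (ℕ; zero; suc)
import Data.Nat as ℕ
open import Data.Integer using (+_)
open import Data.Rational using (ℚ; 0ℚ; _/_; _+_; _*_; _≤_; _<_)
open import Data.Fin using (Fin; zero; suc; _<?_)
open import Data.Fin.Subset using (Subset)
open import Data.Vec using (lookup)
open import Data.Bool using (Bool; true; false; _∧_; if_then_else_)
open import Data.Product using (_×_)
open import Relation.Nullary.Decidable using (isYes)
open import Relation.Binary.PropositionalEquality using (_≡_)

record Graph (n : ℕ) : Set where
  field
    Adj    : Fin n → Fin n → Bool
    sym    : ∀ i j → Adj i j ≡ Adj j i
    irrefl : ∀ i → Adj i i ≡ false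
open Graph public

sumℚ : {n : ℕ} → (Fin n → ℚ) → ℚ
sumℚ {zero}  f = 0ℚ
sumℚ {suc n} f = f zero + sumℚ (λ i → f (suc i))

sumℕ : {n : ℕ} → (Fin n → ℕ) → ℕ
sumℕ {zero}  f = 0
sumℕ {suc n} f = f zero ℕ.+ sumℕ (λ i → f (suc i))

-- each edge {i,j} is counted once, as the ordered pair with i < j
isEdge : {n : ℕ} → Graph n → Fin n → Fin n → Bool
isEdge G i j = isYes (i <? j) ∧ Adj G i j

IsWeightFunction : {n : ℕ} → (Fin n → ℚ) → Set
IsWeightFunction {n} ω = (∀ v → (0ℚ < ω v) × (ω v < + 1 / 1)) × (sumℚ ω ≡ + 1 / 1)

-- uniform weight 1/n (Fin 0 is empty, so the zero case is vacuous)
ωu : (n : ℕ) → Fin n → ℚ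
ωu (suc m) _ = + 1 / suc m

IsHalf : {n : ℕ} → (Fin n → ℚ) → (Fin n → ℚ) → Set
IsHalf ω s = (∀ v → (0ℚ ≤ s v) × (s v ≤ ω v)) × (sumℚ s ≡ + 1 / 2)

edgeWeight : {n : ℕ} → Graph n → (Fin n → ℚ) → ℚ
edgeWeight G s = sumℚ (λ i → sumℚ (λ j → if isEdge G i j then s i * s j else 0ℚ))

IsSparseHalf : {n : ℕ} → Graph n → (Fin n → ℚ) → (Fin n → ℚ) → Set
IsSparseHalf G ω s = IsHalf ω s × (edgeWeight G s ≤ + 1 / 50)

edgesIn : {n : ℕ} → Graph n → Subset n → ℕ
edgesIn G S = sumℕ (λ i → sumℕ (λ j →
  if isEdge G i j ∧ lookup S i ∧ lookup S j then 1 else 0))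

{-# OPTIONS --safe #-}
module Submission where

-- Scaling a half s of the uniform weighting by n gives a point t = n·s of the unit cube
-- with Σ t = n/2 and edge weight Σ_{ij ∈ E} t_i t_j = n² s(E) ≤ n²/50.  The edge weight has
-- no diagonal terms, so along a direction e_a − e_b it is a quadratic in the step whose
-- leading coefficient is −[ab ∈ E] ≤ 0: moving mass between two fractional coordinates in
-- one of the two directions does not increase it.  Moving until one of the two coordinates
-- hits 0 or 1 keeps Σ t and shrinks the set of fractional coordinates, so eventually at most
-- one is left.  The set S of coordinates equal to 1 then has |S| ≤ n/2 < |S| + 1, i.e.
-- |S| = ⌊n/2⌋, and e(S) ≤ Σ_{ij ∈ E} t_i t_j ≤ n²/50.

open import Defs hiding (sym)

-- The rationals are opened only inside this module: the statement at the end uses ℕ's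
-- _*_, _/_ unqualified.
module Rounding where

  open import Algebra.Bundles using (CommutativeRing)
  open import Data.Bool using (Bool; true; false; if_then_else_; _∧_)
  open import Data.Bool.Properties using (∧-zeroʳ)
  open import Data.Empty using (⊥-elim)
  open import Data.Fin using (Fin; zero; suc)
  open import Data.Fin.Properties using (any?; suc-injective) renaming (_≟_ to _≟ᶠ_)
  open import Data.Fin.Subset using (Subset; ∣_∣; _∈_; _∉_; _⊆_; _⊂_)
  open import Data.Fin.Subset.Properties using (p⊂q⇒∣p∣<∣q∣)
  import Data.Integer as ℤ
  import Data.Integer.Properties as ℤ
  open import Data.Nat as ℕ using (ℕ; zero; suc)
  import Data.Nat.Properties as ℕ
  import Data.Nat.DivMod as ℕ
  open import Data.Nat.Coprimality using (1-coprimeTo) renaming (sym to coprime-sym)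
  open import Data.Nat.Induction using (<-wellFounded)
  open import Data.Product using (∃; ∃₂; _×_; _,_; proj₁; proj₂)
  open import Data.Rational hiding (∣_∣)
  open import Data.Rational.Properties
  open import Data.Rational.Solver using (module +-*-Solver)
  import Data.Rational.Unnormalised as ℚᵘ
  import Data.Rational.Unnormalised.Properties as ℚᵘ
  open import Data.Sum using (_⊎_; inj₁; inj₂; [_,_]′)
  open import Data.Vec using (tabulate; lookup)
  open import Data.Vec.Properties using (lookup∘tabulate; []=⇒lookup; lookup⇒[]=)
  open import Function using (_∘_)
  open import Induction.WellFounded using (Acc; acc)
  open import Relation.Binary.PropositionalEquality
  open import Relation.Binary.Definitions using (tri<; tri≈; tri>)
  open import Relation.Nullary using (¬_; Dec; yes; no; does)
  open import Relation.Nullary.Decidable using (dec-true; dec-false; _×-dec_; ¬?)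

  open import Algebra.Properties.Semiring.Sum (CommutativeRing.semiring +-*-commutativeRing)
    using (sum; sum-cong-≗; ∑-distrib-+; *-distribˡ-sum; sum-replicate-zero)
  open +-*-Solver

  fromℕ : ℕ → ℚ
  fromℕ k = ℤ.+ k / 1

  fromℕ-mkℚ : ∀ k → fromℕ k ≡ mkℚ (ℤ.+ k) 0 (coprime-sym (1-coprimeTo k))
  fromℕ-mkℚ k = normalize-coprime (coprime-sym (1-coprimeTo k))

  fromℕ-homo-+ : ∀ a b → fromℕ (a ℕ.+ b) ≡ fromℕ a + fromℕ b
  fromℕ-homo-+ a b = begin
    ℤ.+ (a ℕ.+ b) / 1                          ≡⟨ cong (_/ 1) (cong₂ ℤ._+_ (ℤ.*-identityʳ (ℤ.+ a)) (ℤ.*-identityʳ (ℤ.+ b))) ⟨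
    (ℤ.+ a ℤ.* ℤ.+ 1 ℤ.+ ℤ.+ b ℤ.* ℤ.+ 1) / 1  ≡⟨ cong₂ _+_ (fromℕ-mkℚ a) (fromℕ-mkℚ b) ⟨
    fromℕ a + fromℕ b                          ∎
    where open ≡-Reasoning

  fromℕ-homo-* : ∀ a b → fromℕ (a ℕ.* b) ≡ fromℕ a * fromℕ b
  fromℕ-homo-* a b = begin
    ℤ.+ (a ℕ.* b) / 1      ≡⟨ cong (_/ 1) (ℤ.pos-* a b) ⟩
    (ℤ.+ a ℤ.* ℤ.+ b) / 1  ≡⟨ cong₂ _*_ (fromℕ-mkℚ a) (fromℕ-mkℚ b) ⟨
    fromℕ a * fromℕ b      ∎
    where open ≡-Reasoning

  fromℕ-cancel-≤ : ∀ {a b} → fromℕ a ≤ fromℕ b → a ℕ.≤ b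
  fromℕ-cancel-≤ {a} {b} a≤b = ℤ.drop‿+≤+ (subst₂ ℤ._≤_ (ℤ.*-identityʳ (ℤ.+ a)) (ℤ.*-identityʳ (ℤ.+ b))
    (drop-*≤* (subst₂ _≤_ (fromℕ-mkℚ a) (fromℕ-mkℚ b) a≤b)))

  fromℕ-cancel-< : ∀ {a b} → fromℕ a < fromℕ b → a ℕ.< b
  fromℕ-cancel-< {a} {b} a<b = ℤ.drop‿+<+ (subst₂ ℤ._<_ (ℤ.*-identityʳ (ℤ.+ a)) (ℤ.*-identityʳ (ℤ.+ b))
    (drop-*<* (subst₂ _<_ (fromℕ-mkℚ a) (fromℕ-mkℚ b) a<b)))

  fromℕ-nonNeg : ∀ k → 0ℚ ≤ fromℕ k
  fromℕ-nonNeg k = nonNegative⁻¹ (fromℕ k) {{normalize-nonNeg k 1}}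

  1/n*n≡1 : ∀ d → (ℤ.+ 1 / suc d) * fromℕ (suc d) ≡ 1ℚ
  1/n*n≡1 d = trans (cong₂ _*_ (normalize-coprime (1-coprimeTo (suc d))) (fromℕ-mkℚ (suc d)))
                    (*-inverseˡ (mkℚ (ℤ.+ suc d) 0 (coprime-sym (1-coprimeTo (suc d)))))

  p*1/n*n≡p : ∀ b d → fromℕ b * (ℤ.+ 1 / suc d) * fromℕ (suc d) ≡ fromℕ b
  p*1/n*n≡p b d = begin
    fromℕ b * (ℤ.+ 1 / suc d) * fromℕ (suc d)    ≡⟨ *-assoc (fromℕ b) _ _ ⟩
    fromℕ b * ((ℤ.+ 1 / suc d) * fromℕ (suc d))  ≡⟨ cong (fromℕ b *_) (1/n*n≡1 d) ⟩
    fromℕ b * 1ℚ                                 ≡⟨ *-identityʳ (fromℕ b) ⟩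
    fromℕ b                                      ∎
    where open ≡-Reasoning

  ≤-*1/n⇒*n≤ : ∀ {a b d} → fromℕ a ≤ fromℕ b * (ℤ.+ 1 / suc d) → a ℕ.* suc d ℕ.≤ b
  ≤-*1/n⇒*n≤ {a} {b} {d} a≤b/d = fromℕ-cancel-≤ (begin
    fromℕ (a ℕ.* suc d)                        ≡⟨ fromℕ-homo-* a (suc d) ⟩
    fromℕ a * fromℕ (suc d)                    ≤⟨ *-monoʳ-≤-nonNeg (fromℕ (suc d)) {{normalize-nonNeg (suc d) 1}} a≤b/d ⟩
    fromℕ b * (ℤ.+ 1 / suc d) * fromℕ (suc d)  ≡⟨ p*1/n*n≡p b d ⟩
    fromℕ b                                    ∎)
    where open ≤-Reasoning

  *1/n-<⇒<*n : ∀ {a b d} → fromℕ b * (ℤ.+ 1 / suc d) < fromℕ a → b ℕ.< a ℕ.* suc d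
  *1/n-<⇒<*n {a} {b} {d} b/d<a = fromℕ-cancel-< (begin-strict
    fromℕ b                                    ≡⟨ p*1/n*n≡p b d ⟨
    fromℕ b * (ℤ.+ 1 / suc d) * fromℕ (suc d)  <⟨ *-monoˡ-<-pos (fromℕ (suc d)) {{normalize-pos (suc d) 1}} b/d<a ⟩
    fromℕ a * fromℕ (suc d)                    ≡⟨ fromℕ-homo-* a (suc d) ⟨
    fromℕ (a ℕ.* suc d)                        ∎)
    where open ≤-Reasoning

  *n≤⇒≤/n : ∀ {a b d} → a ℕ.* suc d ℕ.≤ b → fromℕ a ≤ ℤ.+ b / suc d
  *n≤⇒≤/n {a} {b} {d} ad≤b = toℚᵘ-cancel-≤
    (ℚᵘ.≤-respˡ-≃ (ℚᵘ.≃-sym (toℚᵘ-fromℚᵘ (ℚᵘ.mkℚᵘ (ℤ.+ a) 0)))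
    (ℚᵘ.≤-respʳ-≃ (ℚᵘ.≃-sym (toℚᵘ-fromℚᵘ (ℚᵘ.mkℚᵘ (ℤ.+ b) d)))
    (ℚᵘ.*≤* (subst₂ ℤ._≤_ (ℤ.pos-* a (suc d)) (sym (ℤ.*-identityʳ (ℤ.+ b))) (ℤ.+≤+ ad≤b)))))

  m*n≤o<[1+m]*n⇒m≡o/n : ∀ {m n o} → m ℕ.* suc n ℕ.≤ o → o ℕ.< suc m ℕ.* suc n → m ≡ o ℕ./ suc n
  m*n≤o<[1+m]*n⇒m≡o/n {m} {n} {o} lower upper = ℕ.≤-antisym
    (subst (ℕ._≤ o ℕ./ suc n) (ℕ.m*n/n≡m m (suc n)) (ℕ./-monoˡ-≤ (suc n) lower))
    (ℕ.≤-pred (ℕ.m<n*o⇒m/o<n upper))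

  sumℚ≡sum : ∀ {n} (f : Fin n → ℚ) → sumℚ f ≡ sum f
  sumℚ≡sum {zero}  f = refl
  sumℚ≡sum {suc n} f = cong (f zero +_) (sumℚ≡sum (f ∘ suc))

  sumℚ-cong : ∀ {n} {f g : Fin n → ℚ} → (∀ i → f i ≡ g i) → sumℚ f ≡ sumℚ g
  sumℚ-cong {f = f} {g} f≗g = trans (sumℚ≡sum f) (trans (sum-cong-≗ f≗g) (sym (sumℚ≡sum g)))

  sumℚ-+ : ∀ {n} (f g : Fin n → ℚ) → sumℚ (λ i → f i + g i) ≡ sumℚ f + sumℚ g
  sumℚ-+ f g = trans (sumℚ≡sum (λ i → f i + g i)) (trans (∑-distrib-+ f g) (sym (cong₂ _+_ (sumℚ≡sum f) (sumℚ≡sum g))))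

  sumℚ-*ˡ : ∀ {n} (k : ℚ) (f : Fin n → ℚ) → sumℚ (λ i → k * f i) ≡ k * sumℚ f
  sumℚ-*ˡ k f = trans (sumℚ≡sum (λ i → k * f i)) (sym (trans (cong (k *_) (sumℚ≡sum f)) (*-distribˡ-sum k f)))

  sumℚ-zero : ∀ n → sumℚ {n} (λ _ → 0ℚ) ≡ 0ℚ
  sumℚ-zero n = trans (sumℚ≡sum {n} (λ _ → 0ℚ)) (sum-replicate-zero n)

  sumℚ-mono-≤ : ∀ {n} {f g : Fin n → ℚ} → (∀ i → f i ≤ g i) → sumℚ f ≤ sumℚ g
  sumℚ-mono-≤ {zero}  f≤g = ≤-refl
  sumℚ-mono-≤ {suc n} f≤g = +-mono-≤ (f≤g zero) (sumℚ-mono-≤ (f≤g ∘ suc))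

  sumℚ-nonNeg : ∀ {n} {f : Fin n → ℚ} → (∀ i → 0ℚ ≤ f i) → 0ℚ ≤ sumℚ f
  sumℚ-nonNeg {n} {f} f≥0 = subst (_≤ sumℚ f) (sumℚ-zero n) (sumℚ-mono-≤ f≥0)

  sumℚ-nonPos : ∀ {n} {f : Fin n → ℚ} → (∀ i → f i ≤ 0ℚ) → sumℚ f ≤ 0ℚ
  sumℚ-nonPos {n} {f} f≤0 = subst (sumℚ f ≤_) (sumℚ-zero n) (sumℚ-mono-≤ f≤0)

  sumℚ-linear₃ : ∀ {n} (x y : ℚ) (f g h : Fin n → ℚ) →
                 sumℚ (λ i → f i + x * g i + y * h i) ≡ sumℚ f + x * sumℚ g + y * sumℚ h
  sumℚ-linear₃ x y f g h = begin
    sumℚ (λ i → f i + x * g i + y * h i)                ≡⟨ sumℚ-+ (λ i → f i + x * g i) (λ i → y * h i) ⟩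
    sumℚ (λ i → f i + x * g i) + sumℚ (λ i → y * h i)   ≡⟨ cong₂ _+_ (sumℚ-+ f (λ i → x * g i)) (sumℚ-*ˡ y h) ⟩
    sumℚ f + sumℚ (λ i → x * g i) + y * sumℚ h          ≡⟨ cong (λ z → sumℚ f + z + y * sumℚ h) (sumℚ-*ˡ x g) ⟩
    sumℚ f + x * sumℚ g + y * sumℚ h                    ∎
    where open ≡-Reasoning

  sumℚ-single : ∀ {n} (f : Fin n → ℚ) u → (∀ i → u ≢ i → f i ≡ 0ℚ) → sumℚ f ≡ f u
  sumℚ-single {suc n} f zero    off = begin
    f zero + sumℚ (f ∘ suc)   ≡⟨ cong (f zero +_) (trans (sumℚ-cong (λ i → off (suc i) λ ())) (sumℚ-zero n)) ⟩
    f zero + 0ℚ               ≡⟨ +-identityʳ (f zero) ⟩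
    f zero                    ∎
    where open ≡-Reasoning
  sumℚ-single {suc n} f (suc u) off = begin
    f zero + sumℚ (f ∘ suc)   ≡⟨ cong₂ _+_ (off zero λ ())
                                           (sumℚ-single (f ∘ suc) u (λ i u≢i → off (suc i) (u≢i ∘ suc-injective))) ⟩
    0ℚ + f (suc u)            ≡⟨ +-identityˡ (f (suc u)) ⟩
    f (suc u)                 ∎
    where open ≡-Reasoning

  fromℕ-sumℕ : ∀ {n} (f : Fin n → ℕ) → fromℕ (sumℕ f) ≡ sumℚ (fromℕ ∘ f)
  fromℕ-sumℕ {zero}  f = refl
  fromℕ-sumℕ {suc n} f = trans (fromℕ-homo-+ (f zero) _) (cong (fromℕ (f zero) +_) (fromℕ-sumℕ (f ∘ suc)))

  fromℕ-∣tabulate∣ : ∀ {n} (b : Fin n → Bool) → fromℕ ∣ tabulate b ∣ ≡ sumℚ (λ i → if b i then 1ℚ else 0ℚ)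
  fromℕ-∣tabulate∣ {zero}  b = refl
  fromℕ-∣tabulate∣ {suc n} b with b zero
  ... | true  = trans (fromℕ-homo-+ 1 ∣ tabulate (b ∘ suc) ∣) (cong (1ℚ +_) (fromℕ-∣tabulate∣ (b ∘ suc)))
  ... | false = trans (fromℕ-∣tabulate∣ (b ∘ suc)) (sym (+-identityˡ _))

  ∈-tabulate-does⁻ : ∀ {n} {P : Fin n → Set} (P? : ∀ i → Dec (P i)) {i} → i ∈ tabulate (does ∘ P?) → P i
  ∈-tabulate-does⁻ P? {i} i∈ with P? i | trans (sym (lookup∘tabulate (does ∘ P?) i)) ([]=⇒lookup i∈)
  ... | yes p | _ = p
  ... | no _  | ()

  ∈-tabulate-does⁺ : ∀ {n} {P : Fin n → Set} (P? : ∀ i → Dec (P i)) {i} → P i → i ∈ tabulate (does ∘ P?)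
  ∈-tabulate-does⁺ P? {i} p = lookup⇒[]= i _ (trans (lookup∘tabulate (does ∘ P?) i) (dec-true (P? i) p))

  *-nonNeg : ∀ {p q} → 0ℚ ≤ p → 0ℚ ≤ q → 0ℚ ≤ p * q
  *-nonNeg {p} {q} p≥0 q≥0 = nonNegative⁻¹ (p * q) {{nonNeg*nonNeg⇒nonNeg p {{nonNegative p≥0}} q {{nonNegative q≥0}}}}

  *-nonNeg-nonPos : ∀ {p q} → 0ℚ ≤ p → q ≤ 0ℚ → p * q ≤ 0ℚ
  *-nonNeg-nonPos {p} {q} p≥0 q≤0 = nonPositive⁻¹ (p * q) {{nonNeg*nonPos⇒nonPos p {{nonNegative p≥0}} q {{nonPositive q≤0}}}}

  p<q⇒0<q-p : ∀ {p q} → p < q → 0ℚ < q - p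
  p<q⇒0<q-p {p} {q} p<q = subst (_< q - p) (+-inverseʳ p) (+-monoˡ-< (- p) p<q)

  p≤q⇒0≤q-p : ∀ {p q} → p ≤ q → 0ℚ ≤ q - p
  p≤q⇒0≤q-p {p} {q} p≤q = subst (_≤ q - p) (+-inverseʳ p) (+-monoˡ-≤ (- p) p≤q)

  ≤∧≢⇒< : ∀ {p q} → p ≤ q → p ≢ q → p < q
  ≤∧≢⇒< {p} {q} p≤q p≢q with <-cmp p q
  ... | tri< p<q _ _ = p<q
  ... | tri≈ _ p≡q _ = ⊥-elim (p≢q p≡q)
  ... | tri> _ _ p>q = ⊥-elim (<-irrefl refl (<-≤-trans p>q p≤q))

  +-nonPos-≤ : ∀ α {p q} → p ≤ 0ℚ → q ≤ 0ℚ → α + p + q ≤ α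
  +-nonPos-≤ α {p} {q} p≤0 q≤0 = begin
    α + p + q      ≤⟨ +-mono-≤ (+-monoʳ-≤ α p≤0) q≤0 ⟩
    α + 0ℚ + 0ℚ    ≡⟨ trans (+-identityʳ (α + 0ℚ)) (+-identityʳ α) ⟩
    α              ∎
    where open ≤-Reasoning

  concave-descent : ∀ α β {γ x y} → γ ≤ 0ℚ → 0ℚ < x → 0ℚ < y →
                    α + x * β + (x * x) * γ ≤ α ⊎ α + (- y) * β + ((- y) * (- y)) * γ ≤ α
  concave-descent α β {γ} {x} {y} γ≤0 x>0 y>0 with β ≤? 0ℚ
  ... | yes β≤0 = inj₁ (+-nonPos-≤ α (*-nonNeg-nonPos x≥0 β≤0) (*-nonNeg-nonPos (*-nonNeg x≥0 x≥0) γ≤0))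
    where
    x≥0 : 0ℚ ≤ x
    x≥0 = <⇒≤ x>0
  ... | no  β≰0 = inj₂ (+-nonPos-≤ α (subst (_≤ 0ℚ) (*-comm β (- y)) (*-nonNeg-nonPos (<⇒≤ (≰⇒> β≰0)) (neg-antimono-≤ y≥0)))
                                     (*-nonNeg-nonPos (subst (0ℚ ≤_) (sym y²) (*-nonNeg y≥0 y≥0)) γ≤0))
    where
    y≥0 : 0ℚ ≤ y
    y≥0 = <⇒≤ y>0
    y² : (- y) * (- y) ≡ y * y
    y² = solve 1 (λ y → (:- y) :* (:- y) := y :* y) refl y

  δ : ∀ {n} → Fin n → Fin n → ℚ
  δ a i = if does (a ≟ᶠ i) then 1ℚ else 0ℚ

  δ-diag : ∀ {n} (a : Fin n) → δ a a ≡ 1ℚ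
  δ-diag a rewrite dec-true (a ≟ᶠ a) refl = refl

  δ-off : ∀ {n} {a i : Fin n} → a ≢ i → δ a i ≡ 0ℚ
  δ-off {a = a} {i} a≢i rewrite dec-false (a ≟ᶠ i) a≢i = refl

  δ-nonNeg : ∀ {n} (a i : Fin n) → 0ℚ ≤ δ a i
  δ-nonNeg a i with does (a ≟ᶠ i)
  ... | true  = nonNegative⁻¹ 1ℚ
  ... | false = ≤-refl

  sumℚ-δ : ∀ {n} (a : Fin n) → sumℚ (δ a) ≡ 1ℚ
  sumℚ-δ a = trans (sumℚ-single (δ a) a (λ _ → δ-off)) (δ-diag a)

  δ*δ-off : ∀ {n} (a : Fin n) {i j} → i ≢ j → δ a i * δ a j ≡ 0ℚ
  δ*δ-off a {i} {j} i≢j with a ≟ᶠ i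
  ... | yes refl = trans (*-identityˡ (δ a j)) (δ-off i≢j)
  ... | no  _    = *-zeroˡ (δ a j)

  transferDir : ∀ {n} → Fin n → Fin n → Fin n → ℚ
  transferDir a b i = δ a i - δ b i

  sumℚ-transferDir : ∀ {n} (a b : Fin n) → sumℚ (transferDir a b) ≡ 0ℚ
  sumℚ-transferDir a b = begin
    sumℚ (λ i → δ a i - δ b i)                ≡⟨ sumℚ-cong (λ i → solve 2 (λ p q → p :- q := p :+ con (- 1ℚ) :* q)
                                                                       refl (δ a i) (δ b i)) ⟩
    sumℚ (λ i → δ a i + (- 1ℚ) * δ b i)       ≡⟨ sumℚ-+ (δ a) (λ i → (- 1ℚ) * δ b i) ⟩
    sumℚ (δ a) + sumℚ (λ i → (- 1ℚ) * δ b i)  ≡⟨ cong₂ _+_ (sumℚ-δ a)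
                                                   (trans (sumℚ-*ˡ (- 1ℚ) (δ b)) (cong ((- 1ℚ) *_) (sumℚ-δ b))) ⟩
    1ℚ + (- 1ℚ) * 1ℚ                          ≡⟨⟩
    0ℚ                                        ∎
    where open ≡-Reasoning

  transferDir-cross-nonPos : ∀ {n} (a b : Fin n) {i j} → i ≢ j → transferDir a b i * transferDir a b j ≤ 0ℚ
  transferDir-cross-nonPos a b {i} {j} i≢j = begin
    (δ a i - δ b i) * (δ a j - δ b j)        ≡⟨ solve 4 (λ p q r t → (p :- q) :* (r :- t) := (p :* r :+ q :* t) :- (p :* t :+ q :* r))
                                                         refl (δ a i) (δ b i) (δ a j) (δ b j) ⟩
    (δ a i * δ a j + δ b i * δ b j) - mixed  ≡⟨ cong (_- mixed) (cong₂ _+_ (δ*δ-off a i≢j) (δ*δ-off b i≢j)) ⟩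
    0ℚ - mixed                               ≡⟨ +-identityˡ (- mixed) ⟩
    - mixed                                  ≤⟨ neg-antimono-≤ mixed≥0 ⟩
    0ℚ                                       ∎
    where
    open ≤-Reasoning
    mixed : ℚ
    mixed = δ a i * δ b j + δ b i * δ a j
    mixed≥0 : 0ℚ ≤ mixed
    mixed≥0 = +-mono-≤ (*-nonNeg (δ-nonNeg a i) (δ-nonNeg b j)) (*-nonNeg (δ-nonNeg b i) (δ-nonNeg a j))

  isEdge-irrefl : ∀ {n} (G : Graph n) i → isEdge G i i ≡ false
  isEdge-irrefl G i rewrite irrefl G i = ∧-zeroʳ _

  edgeWeight-cong : ∀ {n} (G : Graph n) {s t : Fin n → ℚ} → (∀ i → s i ≡ t i) → edgeWeight G s ≡ edgeWeight G t
  edgeWeight-cong G s≗t =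
    sumℚ-cong (λ i → sumℚ-cong (λ j → cong₂ (λ p q → if isEdge G i j then p * q else 0ℚ) (s≗t i) (s≗t j)))

  if-quadratic : ∀ (e : Bool) x (p q r t : ℚ) →
                 (if e then (p + x * r) * (q + x * t) else 0ℚ) ≡
                 (if e then p * q else 0ℚ) + x * (if e then p * t + r * q else 0ℚ) + (x * x) * (if e then r * t else 0ℚ)
  if-quadratic true  x p q r t = solve 5 (λ x p q r t → (p :+ x :* r) :* (q :+ x :* t) :=
                                   p :* q :+ x :* (p :* t :+ r :* q) :+ (x :* x) :* (r :* t)) refl x p q r t
  if-quadratic false x p q r t = sym (cong₂ (λ u v → 0ℚ + u + v) (*-zeroʳ x) (*-zeroʳ (x * x)))

  edgeWeight-along : ∀ {n} (G : Graph n) (s d : Fin n → ℚ) → ∃ λ β → ∀ x →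
                     edgeWeight G (λ i → s i + x * d i) ≡ edgeWeight G s + x * β + (x * x) * edgeWeight G d
  edgeWeight-along {n} G s d = β , expand
    where
    β : ℚ
    β = sumℚ λ i → sumℚ λ j → if isEdge G i j then s i * d j + d i * s j else 0ℚ
    expand : ∀ x → edgeWeight G (λ i → s i + x * d i) ≡ edgeWeight G s + x * β + (x * x) * edgeWeight G d
    expand x = trans (sumℚ-cong λ i → trans (sumℚ-cong λ j → if-quadratic (isEdge G i j) x (s i) (s j) (d i) (d j))
                                            (sumℚ-linear₃ {n} x (x * x) _ _ _))
                     (sumℚ-linear₃ {n} x (x * x) _ _ _)

  edgeWeight-transferDir-nonPos : ∀ {n} (G : Graph n) (a b : Fin n) → edgeWeight G (transferDir a b) ≤ 0ℚ
  edgeWeight-transferDir-nonPos G a b = sumℚ-nonPos λ i → sumℚ-nonPos λ j → term i j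
    where
    term : ∀ i j → (if isEdge G i j then transferDir a b i * transferDir a b j else 0ℚ) ≤ 0ℚ
    term i j with i ≟ᶠ j
    ... | yes refl rewrite isEdge-irrefl G i = ≤-refl
    ... | no  i≢j with isEdge G i j
    ...   | true  = transferDir-cross-nonPos a b i≢j
    ...   | false = ≤-refl

  transfer : ∀ {n} → Fin n → Fin n → ℚ → (Fin n → ℚ) → Fin n → ℚ
  transfer a b x s i = s i + x * transferDir a b i

  transfer-sum : ∀ {n} (a b : Fin n) x s → sumℚ (transfer a b x s) ≡ sumℚ s
  transfer-sum a b x s = begin
    sumℚ (λ i → s i + x * transferDir a b i)        ≡⟨ sumℚ-+ s (λ i → x * transferDir a b i) ⟩
    sumℚ s + sumℚ (λ i → x * transferDir a b i)     ≡⟨ cong (sumℚ s +_) (sumℚ-*ˡ x (transferDir a b)) ⟩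
    sumℚ s + x * sumℚ (transferDir a b)             ≡⟨ cong (λ z → sumℚ s + x * z) (sumℚ-transferDir a b) ⟩
    sumℚ s + x * 0ℚ                         ≡⟨ cong (sumℚ s +_) (*-zeroʳ x) ⟩
    sumℚ s + 0ℚ                             ≡⟨ +-identityʳ (sumℚ s) ⟩
    sumℚ s                                  ∎
    where open ≡-Reasoning

  transfer-swap : ∀ {n} (a b : Fin n) x s i → transfer b a x s i ≡ transfer a b (- x) s i
  transfer-swap a b x s i = solve 4 (λ p u v y → p :+ y :* (v :- u) := p :+ (:- y) :* (u :- v)) refl (s i) (δ a i) (δ b i) x

  transfer-target : ∀ {n} {a b : Fin n} x s → a ≢ b → transfer a b x s a ≡ s a + x
  transfer-target {a = a} {b} x s a≢b rewrite δ-diag a | δ-off (a≢b ∘ sym) = cong (s a +_) (*-identityʳ x)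

  transfer-source : ∀ {n} {a b : Fin n} x s → a ≢ b → transfer a b x s b ≡ s b - x
  transfer-source {a = a} {b} x s a≢b rewrite δ-diag b | δ-off a≢b =
    cong (s b +_) (trans (sym (neg-distribʳ-* x 1ℚ)) (cong -_ (*-identityʳ x)))

  transfer-elsewhere : ∀ {n} {a b i : Fin n} x s → a ≢ i → b ≢ i → transfer a b x s i ≡ s i
  transfer-elsewhere {i = i} x s a≢i b≢i rewrite δ-off a≢i | δ-off b≢i =
    trans (cong (s i +_) (*-zeroʳ x)) (+-identityʳ (s i))

  InUnitInterval : ℚ → Set
  InUnitInterval x = 0ℚ ≤ x × x ≤ 1ℚ

  InUnitCube : ∀ {n} → (Fin n → ℚ) → Set
  InUnitCube s = ∀ i → InUnitInterval (s i)

  Fractional : ℚ → Set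
  Fractional x = 0ℚ < x × x < 1ℚ

  fractional? : ∀ x → Dec (Fractional x)
  fractional? x = (0ℚ <? x) ×-dec (x <? 1ℚ)

  fractionals : ∀ {n} → (Fin n → ℚ) → Subset n
  fractionals s = tabulate (does ∘ fractional? ∘ s)

  fin-cases₂ : ∀ {n} {P : Fin n → Set} (a b : Fin n) → P a → P b → (∀ {i} → a ≢ i → b ≢ i → P i) → ∀ i → P i
  fin-cases₂ a b pa pb rest i with a ≟ᶠ i | b ≟ᶠ i
  ... | yes refl | _        = pa
  ... | no _     | yes refl = pb
  ... | no a≢i   | no b≢i   = rest a≢i b≢i

  fractionals-⊂ : ∀ {n} {s t : Fin n → ℚ} {a b} → (∀ {i} → a ≢ i → b ≢ i → t i ≡ s i) →
                  Fractional (s a) → Fractional (s b) → ¬ Fractional (t a) ⊎ ¬ Fractional (t b) →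
                  fractionals t ⊂ fractionals s
  fractionals-⊂ {s = s} {t} {a} {b} unchanged fa fb lost = shrinks , dropped lost
    where
    shrinks : fractionals t ⊆ fractionals s
    shrinks {i} = fin-cases₂ a b (λ _ → ∈-tabulate-does⁺ (fractional? ∘ s) fa) (λ _ → ∈-tabulate-does⁺ (fractional? ∘ s) fb)
      (λ a≢i b≢i → ∈-tabulate-does⁺ (fractional? ∘ s) ∘ subst Fractional (unchanged a≢i b≢i)
                                                     ∘ ∈-tabulate-does⁻ (fractional? ∘ t)) i
    dropped : ¬ Fractional (t a) ⊎ ¬ Fractional (t b) → ∃ λ i → i ∈ fractionals s × i ∉ fractionals t
    dropped (inj₁ ¬fa) = a , ∈-tabulate-does⁺ (fractional? ∘ s) fa , ¬fa ∘ ∈-tabulate-does⁻ (fractional? ∘ t)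
    dropped (inj₂ ¬fb) = b , ∈-tabulate-does⁺ (fractional? ∘ s) fb , ¬fb ∘ ∈-tabulate-does⁻ (fractional? ∘ t)

  transfer-inUnitCube : ∀ {n} {a b : Fin n} {x s} → a ≢ b → InUnitCube s →
                        InUnitInterval (s a + x) → InUnitInterval (s b - x) → InUnitCube (transfer a b x s)
  transfer-inUnitCube {a = a} {b} {x} {s} a≢b cube a-in b-in = fin-cases₂ a b
    (subst InUnitInterval (sym (transfer-target x s a≢b)) a-in)
    (subst InUnitInterval (sym (transfer-source x s a≢b)) b-in)
    (λ a≢i b≢i → subst InUnitInterval (sym (transfer-elsewhere x s a≢i b≢i)) (cube _))

  p-q≤p : ∀ {p q} → 0ℚ ≤ q → p - q ≤ p
  p-q≤p {p} {q} q≥0 = subst (p - q ≤_) (+-identityʳ p) (+-monoʳ-≤ p (neg-antimono-≤ q≥0))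

  transfer-saturates : ∀ {n} {a b : Fin n} {s} → a ≢ b → InUnitCube s → Fractional (s a) → Fractional (s b) →
                       ∃ λ x → 0ℚ < x × InUnitCube (transfer a b x s) × fractionals (transfer a b x s) ⊂ fractionals s
  transfer-saturates {a = a} {b} {s} a≢b cube fa fb with 1ℚ - s a ≤? s b
  ... | yes fills =
    x , x>0 , transfer-inUnitCube a≢b cube (subst InUnitInterval (sym a-full) (nonNegative⁻¹ 1ℚ , ≤-refl)) b-in ,
    fractionals-⊂ (transfer-elsewhere x s) fa fb (inj₁ (λ f → <-irrefl (trans (transfer-target x s a≢b) a-full) (proj₂ f)))
    where
    x : ℚ
    x = 1ℚ - s a
    x>0 : 0ℚ < x
    x>0 = p<q⇒0<q-p (proj₂ fa)
    a-full : s a + x ≡ 1ℚ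
    a-full = solve 1 (λ p → p :+ (con 1ℚ :- p) := con 1ℚ) refl (s a)
    b-in : InUnitInterval (s b - x)
    b-in = p≤q⇒0≤q-p fills , ≤-trans (p-q≤p (<⇒≤ x>0)) (proj₂ (cube b))
  ... | no ¬fills =
    s b , proj₁ fb , transfer-inUnitCube a≢b cube a-in (subst InUnitInterval (sym b-empty) (≤-refl , nonNegative⁻¹ 1ℚ)) ,
    fractionals-⊂ (transfer-elsewhere (s b) s) fa fb (inj₂ (λ f → <-irrefl (sym (trans (transfer-source (s b) s a≢b) b-empty)) (proj₁ f)))
    where
    b-empty : s b - s b ≡ 0ℚ
    b-empty = +-inverseʳ (s b)
    a-in : InUnitInterval (s a + s b)
    a-in = +-mono-≤ (proj₁ (cube a)) (proj₁ (cube b)) ,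
           <⇒≤ (subst₂ _<_ (+-comm (s b) (s a)) 1-sa+sa≡1 (+-monoˡ-< (s a) (≰⇒> ¬fills)))
      where
      1-sa+sa≡1 : 1ℚ - s a + s a ≡ 1ℚ
      1-sa+sa≡1 = solve 1 (λ p → con 1ℚ :- p :+ p := con 1ℚ) refl (s a)

  AtMostOneFractional : ∀ {n} → (Fin n → ℚ) → Set
  AtMostOneFractional s = ∀ {i j} → Fractional (s i) → Fractional (s j) → i ≡ j

  atMostOneFractional⊎two : ∀ {n} (s : Fin n → ℚ) →
                            AtMostOneFractional s ⊎ ∃₂ λ a b → a ≢ b × Fractional (s a) × Fractional (s b)
  atMostOneFractional⊎two s with any? (fractional? ∘ s)
  ... | no none = inj₁ (λ fi _ → ⊥-elim (none (_ , fi)))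
  ... | yes (a , fa) with any? (λ b → ¬? (a ≟ᶠ b) ×-dec fractional? (s b))
  ...   | yes (b , a≢b , fb) = inj₂ (a , b , a≢b , fa , fb)
  ...   | no noOther = inj₁ (λ fi fj → trans (onlyA fi) (sym (onlyA fj)))
    where
    onlyA : ∀ {i} → Fractional (s i) → i ≡ a
    onlyA {i} fi with a ≟ᶠ i
    ... | yes a≡i = sym a≡i
    ... | no  a≢i = ⊥-elim (noOther (i , a≢i , fi))

  module _ {n} (G : Graph n) where

    infix 4 _≼_
    _≼_ : (Fin n → ℚ) → (Fin n → ℚ) → Set
    t ≼ s = InUnitCube t × sumℚ t ≡ sumℚ s × edgeWeight G t ≤ edgeWeight G s

    ≼-refl : ∀ {s} → InUnitCube s → s ≼ s
    ≼-refl cube = cube , refl , ≤-refl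

    ≼-trans : ∀ {s t u} → u ≼ t → t ≼ s → u ≼ s
    ≼-trans (cube , sum-ut , ew-ut) (_ , sum-ts , ew-ts) = cube , trans sum-ut sum-ts , ≤-trans ew-ut ew-ts

    transfer-step : ∀ {a b s} → a ≢ b → InUnitCube s → Fractional (s a) → Fractional (s b) →
                    ∃ λ t → t ≼ s × fractionals t ⊂ fractionals s
    transfer-step {a} {b} {s} a≢b cube fa fb
      with transfer-saturates a≢b cube fa fb | transfer-saturates (a≢b ∘ sym) cube fb fa
    ... | x , x>0 , cube-x , ⊂-x | y , y>0 , cube-y , ⊂-y =
      [ forward , backward ]′ (concave-descent (edgeWeight G s) β (edgeWeight-transferDir-nonPos G a b) x>0 y>0)
      where
      β : ℚ
      β = proj₁ (edgeWeight-along G s (transferDir a b))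
      along : ∀ z → edgeWeight G (transfer a b z s) ≡ edgeWeight G s + z * β + (z * z) * edgeWeight G (transferDir a b)
      along = proj₂ (edgeWeight-along G s (transferDir a b))
      forward : edgeWeight G s + x * β + (x * x) * edgeWeight G (transferDir a b) ≤ edgeWeight G s →
                ∃ λ t → t ≼ s × fractionals t ⊂ fractionals s
      forward down = transfer a b x s , (cube-x , transfer-sum a b x s , ≤-trans (≤-reflexive (along x)) down) , ⊂-x
      backward : edgeWeight G s + (- y) * β + ((- y) * (- y)) * edgeWeight G (transferDir a b) ≤ edgeWeight G s →
                 ∃ λ t → t ≼ s × fractionals t ⊂ fractionals s
      backward down = transfer b a y s , (cube-y , transfer-sum b a y s , ≤-trans (≤-reflexive swapped) down) , ⊂-y
        where
        swapped : edgeWeight G (transfer b a y s) ≡ edgeWeight G s + (- y) * β + ((- y) * (- y)) * edgeWeight G (transferDir a b)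
        swapped = trans (edgeWeight-cong G (transfer-swap a b y s)) (along (- y))

    reduce-fractionals : ∀ s → Acc ℕ._<_ ∣ fractionals s ∣ → InUnitCube s → ∃ λ t → t ≼ s × AtMostOneFractional t
    reduce-fractionals s (acc smaller) cube with atMostOneFractional⊎two s
    ... | inj₁ one = s , ≼-refl cube , one
    ... | inj₂ (a , b , a≢b , fa , fb) =
      let t , t≼s , t⊂s = transfer-step a≢b cube fa fb
          u , u≼t , one = reduce-fractionals t (smaller (p⊂q⇒∣p∣<∣q∣ t⊂s)) (proj₁ t≼s)
      in u , ≼-trans u≼t t≼s , one

  unitFloor : ℚ → ℚ
  unitFloor x = if does (x ≟ 1ℚ) then 1ℚ else 0ℚ

  unitFloor-≤ : ∀ {x} → InUnitInterval x → unitFloor x ≤ x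
  unitFloor-≤ {x} (x≥0 , _) with x ≟ 1ℚ
  ... | yes refl = ≤-refl
  ... | no  _    = x≥0

  unitFloor-integral : ∀ {x} → InUnitInterval x → ¬ Fractional x → unitFloor x ≡ x
  unitFloor-integral {x} (x≥0 , x≤1) nf with x ≟ 1ℚ
  ... | yes refl = refl
  ... | no  x≢1  = ≤-antisym x≥0 (≮⇒≥ (λ x>0 → nf (x>0 , ≤∧≢⇒< x≤1 x≢1)))

  unitFloor-fractional : ∀ {x} → Fractional x → unitFloor x ≡ 0ℚ
  unitFloor-fractional {x} (_ , x<1) rewrite dec-false (x ≟ 1ℚ) (λ x≡1 → <-irrefl x≡1 x<1) = refl

  ones : ∀ {n} → (Fin n → ℚ) → Subset n
  ones s = tabulate (λ i → does (s i ≟ 1ℚ))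

  ones-sum-bounds : ∀ {n} {s : Fin n → ℚ} → InUnitCube s → AtMostOneFractional s →
                    fromℕ ∣ ones s ∣ ≤ sumℚ s × sumℚ s < fromℕ (suc ∣ ones s ∣)
  ones-sum-bounds {n} {s} cube one = lower , upper
    where
    k : ℚ
    k = fromℕ ∣ ones s ∣
    rest : Fin n → ℚ
    rest i = s i - unitFloor (s i)
    split : sumℚ s ≡ k + sumℚ rest
    split = begin
      sumℚ s                                 ≡⟨ sumℚ-cong (λ i → solve 2 (λ x f → x := f :+ (x :- f)) refl (s i) (unitFloor (s i))) ⟩
      sumℚ (λ i → unitFloor (s i) + rest i)  ≡⟨ sumℚ-+ (unitFloor ∘ s) rest ⟩
      sumℚ (unitFloor ∘ s) + sumℚ rest       ≡⟨ cong (_+ sumℚ rest) (fromℕ-∣tabulate∣ (λ i → does (s i ≟ 1ℚ))) ⟨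
      k + sumℚ rest                          ∎
      where open ≡-Reasoning
    rest-integral : ∀ {i} → ¬ Fractional (s i) → rest i ≡ 0ℚ
    rest-integral {i} nf = trans (cong (λ f → s i - f) (unitFloor-integral (cube i) nf)) (+-inverseʳ (s i))
    rest<1 : sumℚ rest < 1ℚ
    rest<1 with any? (fractional? ∘ s)
    ... | no none = subst (_< 1ℚ) (sym (trans (sumℚ-cong (λ i → rest-integral (λ fi → none (i , fi)))) (sumℚ-zero n)))
                          (positive⁻¹ 1ℚ)
    ... | yes (u , fu) = subst (_< 1ℚ) (sym (trans (sumℚ-single rest u (λ i u≢i → rest-integral (u≢i ∘ one fu))) rest-u))
                               (proj₂ fu)
      where
      rest-u : rest u ≡ s u
      rest-u = trans (cong (λ f → s u - f) (unitFloor-fractional fu)) (+-identityʳ (s u))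
    lower : k ≤ sumℚ s
    lower = begin
      k                ≡⟨ +-identityʳ k ⟨
      k + 0ℚ           ≤⟨ +-monoʳ-≤ k (sumℚ-nonNeg (λ i → p≤q⇒0≤q-p (unitFloor-≤ (cube i)))) ⟩
      k + sumℚ rest    ≡⟨ split ⟨
      sumℚ s           ∎
      where open ≤-Reasoning
    upper : sumℚ s < fromℕ (suc ∣ ones s ∣)
    upper = begin-strict
      sumℚ s                   ≡⟨ split ⟩
      k + sumℚ rest            <⟨ +-monoʳ-< k rest<1 ⟩
      k + 1ℚ                   ≡⟨ +-comm k 1ℚ ⟩
      1ℚ + k                   ≡⟨ fromℕ-homo-+ 1 ∣ ones s ∣ ⟨
      fromℕ (suc ∣ ones s ∣)   ∎
      where open ≤-Reasoning

  does-≟⇒≡ : ∀ {x y : ℚ} → does (x ≟ y) ≡ true → x ≡ y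
  does-≟⇒≡ {x} {y} with x ≟ y
  ... | yes x≡y = λ _ → x≡y
  ... | no  _   = λ ()

  edgeIndicator-≤ : ∀ (e bp bq : Bool) {p q} → 0ℚ ≤ p → 0ℚ ≤ q → (bp ≡ true → p ≡ 1ℚ) → (bq ≡ true → q ≡ 1ℚ) →
                    fromℕ (if e ∧ bp ∧ bq then 1 else 0) ≤ (if e then p * q else 0ℚ)
  edgeIndicator-≤ false _     _     _   _   _  _  = ≤-refl
  edgeIndicator-≤ true  true  true  _   _   p≡1 q≡1 = ≤-reflexive (sym (cong₂ _*_ (p≡1 refl) (q≡1 refl)))
  edgeIndicator-≤ true  true  false p≥0 q≥0 _  _  = *-nonNeg p≥0 q≥0
  edgeIndicator-≤ true  false _     p≥0 q≥0 _  _  = *-nonNeg p≥0 q≥0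

  edgesIn-ones-≤ : ∀ {n} (G : Graph n) {s} → InUnitCube s → fromℕ (edgesIn G (ones s)) ≤ edgeWeight G s
  edgesIn-ones-≤ {n} G {s} cube = begin
    fromℕ (edgesIn G (ones s))                    ≡⟨ trans (fromℕ-sumℕ (λ i → sumℕ (inOnes i)))
                                                           (sumℚ-cong (λ i → fromℕ-sumℕ (inOnes i))) ⟩
    sumℚ (λ i → sumℚ (λ j → fromℕ (inOnes i j)))  ≤⟨ sumℚ-mono-≤ (λ i → sumℚ-mono-≤ (term i)) ⟩
    edgeWeight G s                                ∎
    where
    open ≤-Reasoning
    inOnes : Fin n → Fin n → ℕ
    inOnes i j = if isEdge G i j ∧ lookup (ones s) i ∧ lookup (ones s) j then 1 else 0
    term : ∀ i j → fromℕ (inOnes i j) ≤ (if isEdge G i j then s i * s j else 0ℚ)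
    term i j = edgeIndicator-≤ (isEdge G i j) (lookup (ones s) i) (lookup (ones s) j) (proj₁ (cube i)) (proj₁ (cube j))
                 (does-≟⇒≡ ∘ trans (sym (lookup∘tabulate _ i))) (does-≟⇒≡ ∘ trans (sym (lookup∘tabulate _ j)))

  integral-rounding : ∀ {n} (G : Graph n) {s} → InUnitCube s →
                      ∃ λ S → (fromℕ ∣ S ∣ ≤ sumℚ s × sumℚ s < fromℕ (suc ∣ S ∣)) × fromℕ (edgesIn G S) ≤ edgeWeight G s
  integral-rounding G {s} cube =
    let t , (cube-t , same-sum , lighter) , one = reduce-fractionals G s (<-wellFounded _) cube
        lower , upper = ones-sum-bounds cube-t one
    in ones t , (subst (fromℕ ∣ ones t ∣ ≤_) same-sum lower , subst (_< fromℕ (suc ∣ ones t ∣)) same-sum upper) ,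
       ≤-trans (edgesIn-ones-≤ G cube-t) lighter

  scale : ∀ {n} → ℚ → (Fin n → ℚ) → Fin n → ℚ
  scale k s i = k * s i

  if-scale : ∀ (e : Bool) k p q → (if e then (k * p) * (k * q) else 0ℚ) ≡ (k * k) * (if e then p * q else 0ℚ)
  if-scale true  k p q = solve 3 (λ k p q → (k :* p) :* (k :* q) := (k :* k) :* (p :* q)) refl k p q
  if-scale false k p q = sym (*-zeroʳ (k * k))

  edgeWeight-scale : ∀ {n} (G : Graph n) k s → edgeWeight G (scale k s) ≡ (k * k) * edgeWeight G s
  edgeWeight-scale {n} G k s = begin
    sumℚ (λ i → sumℚ (λ j → if isEdge G i j then (k * s i) * (k * s j) else 0ℚ))
      ≡⟨ sumℚ-cong (λ i → trans (sumℚ-cong (λ j → if-scale (isEdge G i j) k (s i) (s j))) (sumℚ-*ˡ {n} (k * k) _)) ⟩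
    sumℚ (λ i → (k * k) * sumℚ (λ j → if isEdge G i j then s i * s j else 0ℚ))
      ≡⟨ sumℚ-*ˡ {n} (k * k) _ ⟩
    (k * k) * edgeWeight G s
      ∎
    where open ≡-Reasoning

  scaledHalf-inUnitCube : ∀ {m} {s : Fin (suc m) → ℚ} → IsHalf (ωu (suc m)) s → InUnitCube (scale (fromℕ (suc m)) s)
  scaledHalf-inUnitCube {m} {s} (bounds , _) i = *-nonNeg (fromℕ-nonNeg (suc m)) (proj₁ (bounds i)) , (begin
    fromℕ (suc m) * s i                 ≤⟨ *-monoˡ-≤-nonNeg (fromℕ (suc m)) {{normalize-nonNeg (suc m) 1}} (proj₂ (bounds i)) ⟩
    fromℕ (suc m) * (ℤ.+ 1 / suc m)     ≡⟨ *-comm (fromℕ (suc m)) _ ⟩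
    (ℤ.+ 1 / suc m) * fromℕ (suc m)     ≡⟨ 1/n*n≡1 m ⟩
    1ℚ                                  ∎)
    where open ≤-Reasoning

  sparseUniformHalf-rounding : ∀ {m} (G : Graph (suc m)) {s} → IsSparseHalf G (ωu (suc m)) s →
    ∃ λ S → (fromℕ ∣ S ∣ ≤ fromℕ (suc m) * (ℤ.+ 1 / 2) × fromℕ (suc m) * (ℤ.+ 1 / 2) < fromℕ (suc ∣ S ∣)) ×
            fromℕ (edgesIn G S) ≤ fromℕ (suc m ℕ.* suc m) * (ℤ.+ 1 / 50)
  sparseUniformHalf-rounding {m} G {s} (half@(_ , total) , sparse) =
    let S , (lower , upper) , light = integral-rounding G (scaledHalf-inUnitCube half)
    in S , (subst (fromℕ ∣ S ∣ ≤_) scaled-total lower , subst (_< fromℕ (suc ∣ S ∣)) scaled-total upper) ,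
       ≤-trans light scaled-sparse
    where
    N : ℚ
    N = fromℕ (suc m)
    scaled-total : sumℚ (scale N s) ≡ N * (ℤ.+ 1 / 2)
    scaled-total = trans (sumℚ-*ˡ N s) (cong (N *_) total)
    N*N≥0 : 0ℚ ≤ N * N
    N*N≥0 = *-nonNeg (fromℕ-nonNeg (suc m)) (fromℕ-nonNeg (suc m))
    scaled-sparse : edgeWeight G (scale N s) ≤ fromℕ (suc m ℕ.* suc m) * (ℤ.+ 1 / 50)
    scaled-sparse = begin
      edgeWeight G (scale N s)                  ≡⟨ edgeWeight-scale G N s ⟩
      (N * N) * edgeWeight G s                  ≤⟨ *-monoˡ-≤-nonNeg (N * N) {{nonNegative N*N≥0}} sparse ⟩
      (N * N) * (ℤ.+ 1 / 50)                    ≡⟨ cong (_* (ℤ.+ 1 / 50)) (fromℕ-homo-* (suc m) (suc m)) ⟨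
      fromℕ (suc m ℕ.* suc m) * (ℤ.+ 1 / 50)    ∎
      where open ≤-Reasoning

open import Data.Nat using (ℕ; zero; suc; _*_; _/_)
open import Data.Integer using (+_)
open import Data.Rational using (ℚ)
import Data.Rational as ℚ
open import Data.Fin using (Fin)
open import Data.Fin.Subset using (Subset; ∣_∣)
open import Data.Product using (Σ; ∃; _×_; _,_)
open import Relation.Binary.PropositionalEquality using (_≡_)
open Rounding using (sparseUniformHalf-rounding; m*n≤o<[1+m]*n⇒m≡o/n; ≤-*1/n⇒*n≤; *1/n-<⇒<*n; *n≤⇒≤/n)

lemma2p1 : (n : ℕ) (G : Graph n) → IsWeightFunction (ωu n) →
           Σ (Fin n → ℚ) (λ s → IsSparseHalf G (ωu n) s) →
           ∃ λ (S : Subset n) → (∣ S ∣ ≡ n / 2) × (((+ edgesIn G S) ℚ./ 1) ℚ.≤ ((+ (n * n)) ℚ./ 50))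
lemma2p1 zero    G _ (_ , (_ , ()) , _)
lemma2p1 (suc m) G _ (_ , sparseHalf) =
  let S , (lower , upper) , sparse = sparseUniformHalf-rounding G sparseHalf
  in S , m*n≤o<[1+m]*n⇒m≡o/n (≤-*1/n⇒*n≤ {∣ S ∣} {suc m} {1} lower) (*1/n-<⇒<*n {suc ∣ S ∣} {suc m} {1} upper) ,
     *n≤⇒≤/n {edgesIn G S} (≤-*1/n⇒*n≤ {edgesIn G S} {suc m * suc m} {49} sparse)
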